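{- Let $\mathbb{C}$ be a strict Markov category and $\theta\colon\mathrm{Var}\to\mathrm{ob}(\mathbb{C})$. For any $\mathbb{C}_\theta$-kernel $f\colon X\to Y$ and any finite set $U\subseteq\mathrm{Var}$ with $U\cap X=U\cap Y=\varnothing$, viewing $\mathrm{id}_{[U]}$ as a $\mathbb{C}_\theta$-kernel $U\to U$, the parallel composition $f\oplus\mathrm{id}_{[U]}$ is defined, and $f\oplus\mathrm{id}_{[U]}=\sigma_2\circ(f\otimes\mathrm{id}_{[U]})\circ\sigma_1$ for some rewirings $\sigma_1,\sigma_2$.
   Context: $\mathrm{Var}$ is a countably infinite set with a strict linear order $\prec$; $[S]$ is the $\prec$-increasing list of finite $S\subseteq\mathrm{Var}$. A strict Markov category is a strict symmetric monoidal category where each object $A$ has $\mathsf{copy}_A\colon A\to A\otimes A$, $\mathsf{del}_A\colon A\to\mathsf I$ forming a commutative comonoid compatible with $\otimes$, with $\mathsf{del}$ natural. $\mathbb{C}_\theta$: objects finite lists of variables; morphisms $[x_1..x_m]\to[y_1..y_n]$ are $\mathbb{C}$-morphisms $\theta(x_1)\otimes\cdots\otimes\theta(x_m)\to\theta(y_1)\otimes\cdots\otimes\theta(y_n)$; composition, identities, copy, delete, $\otimes$ (concatenation on objects) from $\mathbb{C}$. Rewirings are symmetry-built permutations of factors according to a permutation of variables. A $\mathbb{C}_\theta$-kernel $f\colon X\to Y$ ($X\subseteq Y$ finite) is a morphism $[X]\to[Y]$ equal to $\sigma\circ(\mathrm{id}_{[X]}\otimes f')\circ\mathsf{copy}_{[X]}$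 for some $f'\colon[X]\to[Y\setminus X]$ (nontrivial part) and rewiring $\sigma$. For kernels $f\colon X\to Y$, $g\colon U\to V$ with nontrivial parts $f',g'$: $f\oplus g$ is defined iff $X\cap U=Y\cap V$ and equals $\sigma_2\circ(\mathrm{id}_{L_1LL_2}\otimes(f'\circ\rho_1)\otimes(g'\circ\rho_2))\circ(\mathrm{id}_{L_1LL_2}\otimes\mathrm{id}_{L_1}\otimes\mathsf{copy}_L\otimes\mathrm{id}_{L_2})\circ\mathsf{copy}_{L_1LL_2}\circ\sigma_1\colon[X\cup U]\to[Y\cup V]$, where $L=[X\cap U]$, $L_1=[X\setminus U]$, $L_2=[U\setminus X]$ and $\sigma_1\colon[X\cup U]\to L_1LL_2$, $\rho_1\colon L_1L\to[X]$, $\rho_2\colon LL_2\to[U]$, $\sigma_2\colon L_1LL_2[Y\setminus X][V\setminus U]\to[Y\cup V]$ are rewirings. -}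

module Defs where

open import Level using (Level; _⊔_; 0ℓ) renaming (suc to lsuc)
open import Data.Nat using (ℕ)
open import Data.Product using (Σ; _×_; _,_)
open import Data.List using (List; []; _∷_; _++_; filter)
open import Data.List.Properties using (++-assoc)
open import Data.List.Relation.Unary.Linked using (Linked)
open import Data.List.Relation.Binary.Subset.Propositional using (_⊆_)
open import Relation.Nullary using (¬?)
open import Relation.Binary using (Rel; IsStrictTotalOrder; tri<; tri≈; tri>)
open import Relation.Binary.PropositionalEquality
  using (_≡_; refl; sym; trans; cong; subst; subst₂)
open import Function.Bundles using (_↔_)

-- Equality of morphisms is propositional equality; strictness of the
-- monoidal structure is expressed by equalities of objects, and the
-- corresponding equations between morphisms are stated after transporting
-- along those object equalities (subst / subst₂).

record StrictMarkovCategory (o ℓ : Level) : Set (lsuc (o ⊔ ℓ)) where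
  infixr 9 _∘_
  infixr 10 _⊗₀_ _⊗₁_
  field
    Obj : Set o
    Hom : Obj → Obj → Set ℓ
    id  : ∀ {A} → Hom A A
    _∘_ : ∀ {A B C} → Hom B C → Hom A B → Hom A C
    identityˡ : ∀ {A B} {f : Hom A B} → id ∘ f ≡ f
    identityʳ : ∀ {A B} {f : Hom A B} → f ∘ id ≡ f
    assoc : ∀ {A B C D} {f : Hom A B} {g : Hom B C} {h : Hom C D} →
            (h ∘ g) ∘ f ≡ h ∘ (g ∘ f)
    I    : Obj
    _⊗₀_ : Obj → Obj → Obj
    _⊗₁_ : ∀ {A B C D} → Hom A B → Hom C D → Hom (A ⊗₀ C) (B ⊗₀ D)
    ⊗-id : ∀ {A B} → id {A} ⊗₁ id {B} ≡ id
    ⊗-∘  : ∀ {A B C D E F} {f : Hom A B} {g : Hom B C} {h : Hom D E} {k : Hom E F} →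
           (g ∘ f) ⊗₁ (k ∘ h) ≡ (g ⊗₁ k) ∘ (f ⊗₁ h)
    unitˡ₀ : ∀ {A} → I ⊗₀ A ≡ A
    unitʳ₀ : ∀ {A} → A ⊗₀ I ≡ A
    assoc₀ : ∀ {A B C} → (A ⊗₀ B) ⊗₀ C ≡ A ⊗₀ (B ⊗₀ C)
    unitˡ₁ : ∀ {A B} {f : Hom A B} → subst₂ Hom unitˡ₀ unitˡ₀ (id {I} ⊗₁ f) ≡ f
    unitʳ₁ : ∀ {A B} {f : Hom A B} → subst₂ Hom unitʳ₀ unitʳ₀ (f ⊗₁ id {I}) ≡ f
    assoc₁ : ∀ {A B C D E F} {f : Hom A B} {g : Hom C D} {h : Hom E F} →
             subst₂ Hom assoc₀ assoc₀ ((f ⊗₁ g) ⊗₁ h) ≡ f ⊗₁ (g ⊗₁ h)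
    σ : ∀ {A B} → Hom (A ⊗₀ B) (B ⊗₀ A)
    σ-natural : ∀ {A B C D} {f : Hom A B} {g : Hom C D} →
                σ ∘ (f ⊗₁ g) ≡ (g ⊗₁ f) ∘ σ
    σ-involutive : ∀ {A B} → σ {B} {A} ∘ σ {A} {B} ≡ id
    hexagon : ∀ {A B C} →
      σ {A} {B ⊗₀ C} ≡
      subst₂ Hom assoc₀ (sym assoc₀)
        ((id {B} ⊗₁ σ {A} {C}) ∘ subst (Hom ((A ⊗₀ B) ⊗₀ C)) assoc₀ (σ {A} {B} ⊗₁ id {C}))
    copy : ∀ {A} → Hom A (A ⊗₀ A)
    del  : ∀ {A} → Hom A I
    copy-counitˡ : ∀ {A} → (del ⊗₁ id) ∘ copy {A} ≡ subst (Hom A) (sym unitˡ₀) id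
    copy-counitʳ : ∀ {A} → (id ⊗₁ del) ∘ copy {A} ≡ subst (Hom A) (sym unitʳ₀) id
    copy-assoc : ∀ {A} →
      subst (Hom A) assoc₀ ((copy ⊗₁ id) ∘ copy {A}) ≡ (id ⊗₁ copy) ∘ copy {A}
    copy-comm : ∀ {A} → σ ∘ copy {A} ≡ copy
    copy-⊗ : ∀ {A B} →
      copy {A ⊗₀ B} ≡
      subst (Hom (A ⊗₀ B)) (trans (cong (A ⊗₀_) assoc₀) (sym assoc₀))
        ((id {A} ⊗₁ (σ {A} {B} ⊗₁ id {B}))
         ∘ subst (Hom (A ⊗₀ B)) (trans assoc₀ (cong (A ⊗₀_) (sym assoc₀)))
             (copy {A} ⊗₁ copy {B}))
    del-⊗  : ∀ {A B} → del {A ⊗₀ B} ≡ subst (Hom (A ⊗₀ B)) unitˡ₀ (del {A} ⊗₁ del {B})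
    copy-I : copy {I} ≡ subst (Hom I) (sym unitˡ₀) id
    del-I  : del {I} ≡ id
    del-natural : ∀ {A B} {f : Hom A B} → del ∘ f ≡ del

record VarStructure : Set₁ where
  field
    Var : Set
    _≺_ : Rel Var 0ℓ
    isStrictTotalOrder : IsStrictTotalOrder _≡_ _≺_
    countable : Var ↔ ℕ

module CTheta {o ℓ} (V : VarStructure) (C : StrictMarkovCategory o ℓ)
              (θ : VarStructure.Var V → StrictMarkovCategory.Obj C) where

  open VarStructure V
  open IsStrictTotalOrder isStrictTotalOrder using (compare; _≟_)
  open StrictMarkovCategory C
  open import Data.List.Membership.DecPropositional _≟_ using (_∈?_)

  -- A finite subset S of Var, given by [S], its ≺-increasing list.
  record FinSet : Set where
    constructor finSet
    field
      ⌈_⌉    : List Var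
      sorted : Linked _≺_ ⌈_⌉
  open FinSet public

  _∩ˡ_ : List Var → List Var → List Var
  xs ∩ˡ ys = filter (_∈? ys) xs

  _∖ˡ_ : List Var → List Var → List Var
  xs ∖ˡ ys = filter (λ x → ¬? (x ∈? ys)) xs

  _∪ˡ_ : List Var → List Var → List Var
  [] ∪ˡ ys = ys
  (x ∷ xs) ∪ˡ ys = go ys
    where
      go : List Var → List Var
      go [] = x ∷ xs
      go (y ∷ ys') with compare x y
      ... | tri< _ _ _ = x ∷ (xs ∪ˡ (y ∷ ys'))
      ... | tri≈ _ _ _ = x ∷ (xs ∪ˡ ys')
      ... | tri> _ _ _ = y ∷ go ys'

  _∩_ _∖_ _∪_ : FinSet → FinSet → List Var
  X ∩ U = ⌈ X ⌉ ∩ˡ ⌈ U ⌉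
  X ∖ U = ⌈ X ⌉ ∖ˡ ⌈ U ⌉
  X ∪ U = ⌈ X ⌉ ∪ˡ ⌈ U ⌉

  ⟦_⟧ : List Var → Obj
  ⟦ [] ⟧ = I
  ⟦ x ∷ xs ⟧ = θ x ⊗₀ ⟦ xs ⟧

  split : ∀ xs ys → ⟦ xs ++ ys ⟧ ≡ ⟦ xs ⟧ ⊗₀ ⟦ ys ⟧
  split [] ys = sym unitˡ₀
  split (x ∷ xs) ys = trans (cong (θ x ⊗₀_) (split xs ys)) (sym assoc₀)

  record HomΘ (xs ys : List Var) : Set ℓ where
    constructor homΘ
    field
      mor : Hom ⟦ xs ⟧ ⟦ ys ⟧
  open HomΘ public

  infixr 9 _∘Θ_
  _∘Θ_ : ∀ {xs ys zs} → HomΘ ys zs → HomΘ xs ys → HomΘ xs zs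
  g ∘Θ f = homΘ (mor g ∘ mor f)

  idΘ : ∀ xs → HomΘ xs xs
  idΘ xs = homΘ id

  infixr 10 _⊗Θ_
  _⊗Θ_ : ∀ {xs ys us vs} → HomΘ xs ys → HomΘ us vs → HomΘ (xs ++ us) (ys ++ vs)
  _⊗Θ_ {xs} {ys} {us} {vs} f g =
    homΘ (subst₂ Hom (sym (split xs us)) (sym (split ys vs)) (mor f ⊗₁ mor g))

  copyΘ : ∀ xs → HomΘ xs (xs ++ xs)
  copyΘ xs = homΘ (subst (Hom ⟦ xs ⟧) (sym (split xs xs)) copy)

  castΘ : ∀ {xs xs' ys ys'} → xs ≡ xs' → ys ≡ ys' → HomΘ xs ys → HomΘ xs' ys'
  castΘ = subst₂ HomΘ

  data Rewiring : List Var → List Var → Set where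
    r-id  : ∀ xs → Rewiring xs xs
    r-∘   : ∀ {xs ys zs} → Rewiring ys zs → Rewiring xs ys → Rewiring xs zs
    r-⊗   : ∀ {xs ys us vs} → Rewiring xs ys → Rewiring us vs → Rewiring (xs ++ us) (ys ++ vs)
    r-sym : ∀ xs ys → Rewiring (xs ++ ys) (ys ++ xs)

  ⟦_⟧ʳ : ∀ {xs ys} → Rewiring xs ys → HomΘ xs ys
  ⟦ r-id xs ⟧ʳ = idΘ xs
  ⟦ r-∘ r s ⟧ʳ = ⟦ r ⟧ʳ ∘Θ ⟦ s ⟧ʳ
  ⟦ r-⊗ r s ⟧ʳ = ⟦ r ⟧ʳ ⊗Θ ⟦ s ⟧ʳ
  ⟦ r-sym xs ys ⟧ʳ = homΘ (subst₂ Hom (sym (split xs ys)) (sym (split ys xs)) σ)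

  NontrivialPart : (X Y : FinSet) → HomΘ ⌈ X ⌉ ⌈ Y ⌉ → HomΘ ⌈ X ⌉ (Y ∖ X) → Set ℓ
  NontrivialPart X Y f f' =
    Σ (Rewiring (⌈ X ⌉ ++ (Y ∖ X)) ⌈ Y ⌉) λ σ' →
      f ≡ ⟦ σ' ⟧ʳ ∘Θ (idΘ ⌈ X ⌉ ⊗Θ f') ∘Θ copyΘ ⌈ X ⌉

  IsKernel : (X Y : FinSet) → HomΘ ⌈ X ⌉ ⌈ Y ⌉ → Set ℓ
  IsKernel X Y f = (⌈ X ⌉ ⊆ ⌈ Y ⌉) × Σ (HomΘ ⌈ X ⌉ (Y ∖ X)) (NontrivialPart X Y f)

  IsOplus : (X Y U W : FinSet) → HomΘ ⌈ X ⌉ ⌈ Y ⌉ → HomΘ ⌈ U ⌉ ⌈ W ⌉ →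
            HomΘ (X ∪ U) (Y ∪ W) → Set ℓ
  IsOplus X Y U W f g h =
    (X ∩ U ≡ Y ∩ W) ×
    Σ (HomΘ ⌈ X ⌉ (Y ∖ X)) λ f' → NontrivialPart X Y f f' ×
    Σ (HomΘ ⌈ U ⌉ (W ∖ U)) λ g' → NontrivialPart U W g g' ×
    Σ (Rewiring (X ∪ U) (L₁ ++ L ++ L₂)) λ σ₁ →
    Σ (Rewiring (L₁ ++ L) ⌈ X ⌉) λ ρ₁ →
    Σ (Rewiring (L ++ L₂) ⌈ U ⌉) λ ρ₂ →
    Σ (Rewiring ((L₁ ++ L ++ L₂) ++ ((Y ∖ X) ++ (W ∖ U))) (Y ∪ W)) λ σ₂ →
      h ≡ ⟦ σ₂ ⟧ʳ
          ∘Θ (idΘ (L₁ ++ L ++ L₂) ⊗Θ castΘ re refl ((f' ∘Θ ⟦ ρ₁ ⟧ʳ) ⊗Θ (g' ∘Θ ⟦ ρ₂ ⟧ʳ)))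
          ∘Θ (idΘ (L₁ ++ L ++ L₂) ⊗Θ (idΘ L₁ ⊗Θ (copyΘ L ⊗Θ idΘ L₂)))
          ∘Θ copyΘ (L₁ ++ L ++ L₂)
          ∘Θ ⟦ σ₁ ⟧ʳ
    where
      L L₁ L₂ : List Var
      L  = X ∩ U
      L₁ = X ∖ U
      L₂ = U ∖ X
      re : (L₁ ++ L) ++ (L ++ L₂) ≡ L₁ ++ ((L ++ L) ++ L₂)
      re = trans (++-assoc L₁ L (L ++ L₂)) (cong (L₁ ++_) (sym (++-assoc L L L₂)))

module Submission where

-- Disjointness makes L = X ∩ U empty, so copy_L is the identity and the
-- nontrivial part g' of id_U is a morphism into the unit, i.e. a deletion.
-- Then f ⊕ id_U is σ₂ ∘ (id ⊗ (f'ρ ⊗ del)) ∘ copy_{X⊗U} ∘ σ₁.  Splitting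
-- copy_{X⊗U} into copy_X ⊗ copy_U and deleting the second copy of U by the
-- counit law leaves the graph (id ⊗ f'ρ) ∘ copy_X of f'ρ next to id_U.
-- Rewirings are deterministic (copy commutes with them) and invertible, so
-- that graph is f itself up to rewirings.

open import Defs
open import Level using (Level; _⊔_)
open import Data.Product using (Σ; _×_; _,_)
open import Data.List using (List; []; _++_)
open import Data.List.Properties using (filter-all; filter-none; ++-identityʳ; ++-assoc)
open import Data.List.Relation.Unary.All using (tabulate)
open import Data.List.Relation.Binary.Disjoint.Propositional using (Disjoint)
open import Relation.Nullary using (¬?)
open import Relation.Binary using (IsStrictTotalOrder)
open import Relation.Binary.PropositionalEquality

module HeterogeneousHom {o ℓ} (C : StrictMarkovCategory o ℓ) where
  open StrictMarkovCategory C

  -- Equality of morphisms whose (co)domains are only propositionally equal,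
  -- as produced by the strictness equations and by ⟦ xs ++ ys ⟧.
  infix 4 _≋_
  data _≋_ {A B : Obj} (f : Hom A B) : {A' B' : Obj} → Hom A' B' → Set (o ⊔ ℓ) where
    ≋-refl : f ≋ f

  private variable
    A A' B B' B₂ B₂' D D' E E' F : Obj

  ≋-sym : {f : Hom A B} {g : Hom A' B'} → f ≋ g → g ≋ f
  ≋-sym ≋-refl = ≋-refl

  ≋-trans : {f : Hom A B} {g : Hom A' B'} {h : Hom D E} → f ≋ g → g ≋ h → f ≋ h
  ≋-trans ≋-refl q = q

  ≋⇒≡ : {f g : Hom A B} → f ≋ g → f ≡ g
  ≋⇒≡ ≋-refl = refl

  ≡⇒≋ : {f g : Hom A B} → f ≡ g → f ≋ g
  ≡⇒≋ refl = ≋-refl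

  infix  1 begin≋_
  infixr 2 _≋⟨_⟩_
  infix  3 _∎≋
  begin≋_ : {f : Hom A B} {g : Hom A' B'} → f ≋ g → f ≋ g
  begin≋ p = p
  _≋⟨_⟩_ : (f : Hom A B) {g : Hom A' B'} {h : Hom D E} → f ≋ g → g ≋ h → f ≋ h
  f ≋⟨ p ⟩ q = ≋-trans p q
  _∎≋ : (f : Hom A B) → f ≋ f
  f ∎≋ = ≋-refl

  subst₂-≋ : (p : A ≡ A') (q : B ≡ B') (f : Hom A B) → subst₂ Hom p q f ≋ f
  subst₂-≋ refl refl f = ≋-refl

  subst-≋ : (q : B ≡ B') (f : Hom A B) → subst (Hom A) q f ≋ f
  subst-≋ refl f = ≋-refl

  infixr 9 _∘⟨_⟩_
  _∘⟨_⟩_ : Hom B' D → B ≡ B' → Hom A B → Hom A D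
  g ∘⟨ p ⟩ f = g ∘ subst (Hom _) p f

  ∘⟨⟩-resp-≋ : {f : Hom A B} {f' : Hom A' B₂} {g : Hom B' D} {g' : Hom B₂' D'} →
               f ≋ f' → g ≋ g' → (p : B ≡ B') (p' : B₂ ≡ B₂') → g ∘⟨ p ⟩ f ≋ g' ∘⟨ p' ⟩ f'
  ∘⟨⟩-resp-≋ ≋-refl ≋-refl refl refl = ≋-refl

  ∘-resp-≋ : {f : Hom A B} {f' : Hom A' B₂} {g : Hom B D} {g' : Hom B₂ D'} →
             f ≋ f' → g ≋ g' → g ∘ f ≋ g' ∘ f'
  ∘-resp-≋ p q = ∘⟨⟩-resp-≋ p q refl refl

  ⊗-resp-≋ : {f : Hom A B} {f' : Hom A' B'} {g : Hom D E} {g' : Hom D' E'} →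
             f ≋ f' → g ≋ g' → f ⊗₁ g ≋ f' ⊗₁ g'
  ⊗-resp-≋ ≋-refl ≋-refl = ≋-refl

  ∘⟨⟩-assoc : {f : Hom A B} {g : Hom B' D} {h : Hom D' E} (p : D ≡ D') (q : B ≡ B') →
              (h ∘⟨ p ⟩ g) ∘⟨ q ⟩ f ≋ h ∘⟨ p ⟩ (g ∘⟨ q ⟩ f)
  ∘⟨⟩-assoc refl refl = ≡⇒≋ assoc

  ∘⟨⟩-identityˡ : {f : Hom A B} (p : B ≡ B') → id {B'} ∘⟨ p ⟩ f ≋ f
  ∘⟨⟩-identityˡ refl = ≡⇒≋ identityˡ

  ∘⟨⟩-identityʳ : {g : Hom B' D} (p : B ≡ B') → g ∘⟨ p ⟩ id {B} ≋ g
  ∘⟨⟩-identityʳ refl = ≡⇒≋ identityʳ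

  ∘⟨⟩-elimˡ : {K : Hom B' D'} → K ≋ id {E} → (p : B ≡ B') (f : Hom A B) → K ∘⟨ p ⟩ f ≋ f
  ∘⟨⟩-elimˡ ≋-refl p f = ∘⟨⟩-identityˡ p

  id-≋ : A ≡ A' → id {A} ≋ id {A'}
  id-≋ refl = ≋-refl

  copy-≋ : A ≡ A' → copy {A} ≋ copy {A'}
  copy-≋ refl = ≋-refl

  ⊗-∘⟨⟩ : {f : Hom A B} {g : Hom B' B₂} {h : Hom D E} {k : Hom E' F} →
          (p : B ≡ B') (q : E ≡ E') (r : B ⊗₀ E ≡ B' ⊗₀ E') →
          (g ⊗₁ k) ∘⟨ r ⟩ (f ⊗₁ h) ≋ (g ∘⟨ p ⟩ f) ⊗₁ (k ∘⟨ q ⟩ h)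
  ⊗-∘⟨⟩ refl refl refl = ≡⇒≋ (sym ⊗-∘)

  ⊗-id-≋ : id {A} ⊗₁ id {B} ≋ id {A ⊗₀ B}
  ⊗-id-≋ = ≡⇒≋ ⊗-id

  ⊗-assoc-≋ : {f : Hom A B} {g : Hom D E} {h : Hom E' F} → (f ⊗₁ g) ⊗₁ h ≋ f ⊗₁ (g ⊗₁ h)
  ⊗-assoc-≋ = ≋-trans (≋-sym (subst₂-≋ assoc₀ assoc₀ _)) (≡⇒≋ assoc₁)

  ⊗-unitʳ-≋ : {f : Hom A B} → f ⊗₁ id {I} ≋ f
  ⊗-unitʳ-≋ = ≋-trans (≋-sym (subst₂-≋ unitʳ₀ unitʳ₀ _)) (≡⇒≋ unitʳ₁)

module MarkovLaws {o ℓ} (C : StrictMarkovCategory o ℓ) where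
  open StrictMarkovCategory C
  open HeterogeneousHom C

  private variable
    A A' B B' D : Obj

  Deterministic : Hom A B → Set ℓ
  Deterministic f = copy ∘ f ≡ (f ⊗₁ f) ∘ copy

  graph : Hom A B → Hom A (A ⊗₀ B)
  graph f = (id ⊗₁ f) ∘ copy

  shuffle₀ : (A ⊗₀ A) ⊗₀ (B ⊗₀ B) ≡ A ⊗₀ ((A ⊗₀ B) ⊗₀ B)
  shuffle₀ {A} = trans assoc₀ (cong (A ⊗₀_) (sym assoc₀))

  unshuffle₀ : A ⊗₀ ((B ⊗₀ A) ⊗₀ B) ≡ (A ⊗₀ B) ⊗₀ (A ⊗₀ B)
  unshuffle₀ {A} = trans (cong (A ⊗₀_) assoc₀) (sym assoc₀)

  copy-⊗-≋ : copy {A ⊗₀ B} ≋ (id {A} ⊗₁ (σ {A} {B} ⊗₁ id {B})) ∘⟨ shuffle₀ ⟩ (copy {A} ⊗₁ copy {B})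
  copy-⊗-≋ = ≋-trans (≡⇒≋ copy-⊗) (subst-≋ _ _)

  graph-del : graph (del {A}) ≋ id {A}
  graph-del = ≋-trans (≡⇒≋ copy-counitʳ) (subst-≋ _ _)

  copy-I-≋ : copy {I} ≋ id {I}
  copy-I-≋ = ≋-trans (≡⇒≋ copy-I) (subst-≋ _ _)

  hexagon-≋ : σ {A} {B ⊗₀ D} ≋ (id {B} ⊗₁ σ {A} {D}) ∘⟨ assoc₀ ⟩ (σ {A} {B} ⊗₁ id {D})
  hexagon-≋ = ≋-trans (≡⇒≋ hexagon) (subst₂-≋ _ _ _)

  del-unique : (g : Hom A I) → g ≡ del
  del-unique g = trans (sym identityˡ) (trans (cong (_∘ g) (sym del-I)) del-natural)

  deterministic-⊗ : {f : Hom A A'} {g : Hom B B'} →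
                    Deterministic f → Deterministic g → Deterministic (f ⊗₁ g)
  deterministic-⊗ {A} {A'} {B} {B'} {f} {g} cf cg = ≋⇒≡ (begin≋
      copy ∘ (f ⊗₁ g)
    ≋⟨ ∘-resp-≋ ≋-refl copy-⊗-≋ ⟩
      ((id ⊗₁ (σ ⊗₁ id)) ∘⟨ shuffle₀ {A'} {B'} ⟩ (copy ⊗₁ copy)) ∘ (f ⊗₁ g)
    ≋⟨ ∘⟨⟩-assoc shuffle₀ refl ⟩
      (id ⊗₁ (σ ⊗₁ id)) ∘⟨ shuffle₀ {A'} {B'} ⟩ ((copy ⊗₁ copy) ∘ (f ⊗₁ g))
    ≋⟨ ∘⟨⟩-resp-≋ (≡⇒≋ (trans (sym ⊗-∘) (trans (cong₂ _⊗₁_ cf cg) ⊗-∘))) ≋-refl shuffle₀ shuffle₀ ⟩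
      (id ⊗₁ (σ ⊗₁ id)) ∘⟨ shuffle₀ {A'} {B'} ⟩ (((f ⊗₁ f) ⊗₁ (g ⊗₁ g)) ∘ (copy ⊗₁ copy))
    ≋⟨ ≋-sym (∘⟨⟩-assoc shuffle₀ refl) ⟩
      ((id ⊗₁ (σ ⊗₁ id)) ∘⟨ shuffle₀ {A'} {B'} ⟩ ((f ⊗₁ f) ⊗₁ (g ⊗₁ g))) ∘ (copy ⊗₁ copy)
    ≋⟨ ∘⟨⟩-resp-≋ ≋-refl swap-middle-natural refl shuffle₀ ⟩
      ((f ⊗₁ ((g ⊗₁ f) ⊗₁ g)) ∘ (id ⊗₁ (σ ⊗₁ id))) ∘⟨ shuffle₀ {A} {B} ⟩ (copy ⊗₁ copy)
    ≋⟨ ∘⟨⟩-assoc refl shuffle₀ ⟩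
      (f ⊗₁ ((g ⊗₁ f) ⊗₁ g)) ∘ ((id ⊗₁ (σ ⊗₁ id)) ∘⟨ shuffle₀ {A} {B} ⟩ (copy ⊗₁ copy))
    ≋⟨ ∘⟨⟩-resp-≋ (≋-sym (copy-⊗-≋ {A} {B})) (≋-trans (⊗-resp-≋ ≋-refl ⊗-assoc-≋) (≋-sym ⊗-assoc-≋)) refl refl ⟩
      ((f ⊗₁ g) ⊗₁ (f ⊗₁ g)) ∘ copy
    ∎≋)
    where
      swap-middle-natural : (id ⊗₁ (σ ⊗₁ id)) ∘⟨ shuffle₀ {A'} {B'} ⟩ ((f ⊗₁ f) ⊗₁ (g ⊗₁ g)) ≋ (f ⊗₁ ((g ⊗₁ f) ⊗₁ g)) ∘ (id ⊗₁ (σ ⊗₁ id))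
      swap-middle-natural = begin≋
          (id ⊗₁ (σ ⊗₁ id)) ∘⟨ shuffle₀ {A'} {B'} ⟩ ((f ⊗₁ f) ⊗₁ (g ⊗₁ g))
        ≋⟨ ∘⟨⟩-resp-≋ (≋-trans ⊗-assoc-≋ (⊗-resp-≋ ≋-refl (≋-sym ⊗-assoc-≋))) ≋-refl shuffle₀ refl ⟩
          (id ⊗₁ (σ ⊗₁ id)) ∘ (f ⊗₁ ((f ⊗₁ g) ⊗₁ g))
        ≋⟨ ≡⇒≋ (trans (sym ⊗-∘) (trans (cong₂ _⊗₁_ (trans identityˡ (sym identityʳ))
              (trans (sym ⊗-∘) (trans (cong₂ _⊗₁_ σ-natural (trans identityˡ (sym identityʳ))) ⊗-∘))) ⊗-∘)) ⟩
          (f ⊗₁ ((g ⊗₁ f) ⊗₁ g)) ∘ (id ⊗₁ (σ ⊗₁ id))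
        ∎≋

  hexagon′-≋ : σ {A ⊗₀ B} {D} ≋ (σ {A} {D} ⊗₁ id {B}) ∘⟨ sym assoc₀ ⟩ (id {A} ⊗₁ σ {B} {D})
  hexagon′-≋ {A} {B} {D} = begin≋
      σ {A ⊗₀ B} {D}
    ≋⟨ ≋-sym (∘⟨⟩-identityˡ refl) ⟩
      id ∘ σ {A ⊗₀ B} {D}
    ≋⟨ ∘⟨⟩-resp-≋ ≋-refl (≋-sym inverts-σ) refl refl ⟩
      (swap₂ ∘⟨ assoc₀ ⟩ σ {D} {A ⊗₀ B}) ∘ σ {A ⊗₀ B} {D}
    ≋⟨ ∘⟨⟩-assoc assoc₀ refl ⟩
      swap₂ ∘⟨ assoc₀ ⟩ (σ {D} {A ⊗₀ B} ∘ σ {A ⊗₀ B} {D})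
    ≋⟨ ∘⟨⟩-resp-≋ (≡⇒≋ σ-involutive) ≋-refl assoc₀ assoc₀ ⟩
      swap₂ ∘⟨ assoc₀ ⟩ id
    ≋⟨ ∘⟨⟩-identityʳ assoc₀ ⟩
      swap₂
    ∎≋
    where
      swap₂ : Hom (A ⊗₀ (B ⊗₀ D)) ((D ⊗₀ A) ⊗₀ B)
      swap₂ = (σ {A} {D} ⊗₁ id {B}) ∘⟨ sym assoc₀ ⟩ (id {A} ⊗₁ σ {B} {D})
      cancel-σ : swap₂ ∘ (id {A} ⊗₁ σ {D} {B}) ≋ σ {A} {D} ⊗₁ id {B}
      cancel-σ = begin≋
          swap₂ ∘ (id {A} ⊗₁ σ {D} {B})
        ≋⟨ ∘⟨⟩-assoc (sym assoc₀) refl ⟩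
          (σ {A} {D} ⊗₁ id {B}) ∘⟨ sym assoc₀ ⟩ ((id {A} ⊗₁ σ {B} {D}) ∘ (id {A} ⊗₁ σ {D} {B}))
        ≋⟨ ∘⟨⟩-resp-≋ (≡⇒≋ (trans (sym ⊗-∘) (trans (cong₂ _⊗₁_ identityˡ σ-involutive) ⊗-id))) ≋-refl (sym assoc₀) (sym assoc₀) ⟩
          (σ {A} {D} ⊗₁ id {B}) ∘⟨ sym assoc₀ ⟩ id
        ≋⟨ ∘⟨⟩-identityʳ (sym assoc₀) ⟩
          σ {A} {D} ⊗₁ id {B}
        ∎≋
      inverts-σ : swap₂ ∘⟨ assoc₀ ⟩ σ {D} {A ⊗₀ B} ≋ id {D ⊗₀ (A ⊗₀ B)}
      inverts-σ = begin≋
          swap₂ ∘⟨ assoc₀ ⟩ σ {D} {A ⊗₀ B}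
        ≋⟨ ∘⟨⟩-resp-≋ hexagon-≋ ≋-refl assoc₀ refl ⟩
          swap₂ ∘ ((id {A} ⊗₁ σ {D} {B}) ∘⟨ assoc₀ ⟩ (σ {D} {A} ⊗₁ id {B}))
        ≋⟨ ≋-sym (∘⟨⟩-assoc refl assoc₀) ⟩
          (swap₂ ∘ (id {A} ⊗₁ σ {D} {B})) ∘⟨ assoc₀ ⟩ (σ {D} {A} ⊗₁ id {B})
        ≋⟨ ∘⟨⟩-resp-≋ ≋-refl cancel-σ assoc₀ refl ⟩
          (σ {A} {D} ⊗₁ id {B}) ∘ (σ {D} {A} ⊗₁ id {B})
        ≋⟨ ≡⇒≋ (trans (sym ⊗-∘) (trans (cong₂ _⊗₁_ σ-involutive identityˡ) ⊗-id)) ⟩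
          id {(D ⊗₀ A) ⊗₀ B}
        ≋⟨ id-≋ assoc₀ ⟩
          id
        ∎≋

  interchange-σ : (id {B} ⊗₁ (σ {B} {A} ⊗₁ id {A})) ∘⟨ shuffle₀ {B} {A} ⟩ σ {A ⊗₀ A} {B ⊗₀ B}
        ≋ (σ {A} {B} ⊗₁ σ {A} {B}) ∘⟨ unshuffle₀ ⟩ (id {A} ⊗₁ (σ {A} {B} ⊗₁ id {B}))
  interchange-σ {B} {A} = begin≋
      (id {B} ⊗₁ (t ⊗₁ id {A})) ∘⟨ shuffle₀ {B} {A} ⟩ σ {A ⊗₀ A} {B ⊗₀ B}
    ≋⟨ ∘⟨⟩-resp-≋ hexagon-≋ ≋-refl (shuffle₀ {B} {A}) e₁ ⟩
      (id {B} ⊗₁ (t ⊗₁ id {A})) ∘⟨ e₁ ⟩ ((id {B} ⊗₁ σ {A ⊗₀ A} {B}) ∘⟨ assoc₀ ⟩ (σ {A ⊗₀ A} {B} ⊗₁ id {B}))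
    ≋⟨ ∘⟨⟩-resp-≋ (∘⟨⟩-resp-≋ (⊗-resp-≋ hexagon′-≋ ≋-refl) (⊗-resp-≋ ≋-refl hexagon′-≋) assoc₀ e₂) ≋-refl e₁ refl ⟩
      (id {B} ⊗₁ (t ⊗₁ id {A})) ∘ ((id {B} ⊗₁ swap₂) ∘⟨ e₂ ⟩ (swap₂ ⊗₁ id {B}))
    ≋⟨ ≋-sym (∘⟨⟩-assoc refl e₂) ⟩
      ((id {B} ⊗₁ (t ⊗₁ id {A})) ∘ (id {B} ⊗₁ swap₂)) ∘⟨ e₂ ⟩ (swap₂ ⊗₁ id {B})
    ≋⟨ ∘⟨⟩-resp-≋ ≋-refl cancel-inner-σ e₂ e₂ ⟩
      (id {B} ⊗₁ (id {A} ⊗₁ s)) ∘⟨ e₂ ⟩ (swap₂ ⊗₁ id {B})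
    ≋⟨ ∘⟨⟩-resp-≋ split-swap₂ ≋-refl e₂ e₂ ⟩
      (id {B} ⊗₁ (id {A} ⊗₁ s)) ∘⟨ e₂ ⟩ (((s ⊗₁ id {A}) ⊗₁ id {B}) ∘⟨ e₃ ⟩ ((id {A} ⊗₁ s) ⊗₁ id {B}))
    ≋⟨ ≋-sym (∘⟨⟩-assoc e₂ e₃) ⟩
      ((id {B} ⊗₁ (id {A} ⊗₁ s)) ∘⟨ e₂ ⟩ ((s ⊗₁ id {A}) ⊗₁ id {B})) ∘⟨ e₃ ⟩ ((id {A} ⊗₁ s) ⊗₁ id {B})
    ≋⟨ ∘⟨⟩-resp-≋ ≋-refl σ⊗σ-factor e₃ e₄ ⟩
      (s ⊗₁ s) ∘⟨ e₄ ⟩ ((id {A} ⊗₁ s) ⊗₁ id {B})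
    ≋⟨ ∘⟨⟩-resp-≋ ⊗-assoc-≋ ≋-refl e₄ _ ⟩
      (s ⊗₁ s) ∘⟨ unshuffle₀ ⟩ (id {A} ⊗₁ (s ⊗₁ id {B}))
    ∎≋
    where
      s = σ {A} {B}
      t = σ {B} {A}
      e₁ : B ⊗₀ (B ⊗₀ (A ⊗₀ A)) ≡ B ⊗₀ ((B ⊗₀ A) ⊗₀ A)
      e₁ = cong (B ⊗₀_) (sym assoc₀)
      e₂ : ((B ⊗₀ A) ⊗₀ A) ⊗₀ B ≡ B ⊗₀ (A ⊗₀ (A ⊗₀ B))
      e₂ = trans assoc₀ assoc₀
      e₃ : (A ⊗₀ (B ⊗₀ A)) ⊗₀ B ≡ ((A ⊗₀ B) ⊗₀ A) ⊗₀ B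
      e₃ = cong (_⊗₀ B) (sym assoc₀)
      e₄ : (A ⊗₀ (B ⊗₀ A)) ⊗₀ B ≡ (A ⊗₀ B) ⊗₀ (A ⊗₀ B)
      e₄ = trans (cong (_⊗₀ B) (sym assoc₀)) assoc₀
      swap₂ : Hom (A ⊗₀ (A ⊗₀ B)) ((B ⊗₀ A) ⊗₀ A)
      swap₂ = (s ⊗₁ id {A}) ∘⟨ sym assoc₀ ⟩ (id {A} ⊗₁ s)
      cancel-inner-σ : (id {B} ⊗₁ (t ⊗₁ id {A})) ∘ (id {B} ⊗₁ swap₂) ≋ id {B} ⊗₁ (id {A} ⊗₁ s)
      cancel-inner-σ = begin≋
          (id {B} ⊗₁ (t ⊗₁ id {A})) ∘ (id {B} ⊗₁ swap₂)
        ≋⟨ ≡⇒≋ (sym ⊗-∘) ⟩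
          (id ∘ id) ⊗₁ ((t ⊗₁ id {A}) ∘ swap₂)
        ≋⟨ ⊗-resp-≋ (≡⇒≋ identityˡ) cancel-σ ⟩
          id {B} ⊗₁ (id {A} ⊗₁ s)
        ∎≋
        where
          cancel-σ : (t ⊗₁ id {A}) ∘ swap₂ ≋ id {A} ⊗₁ s
          cancel-σ = begin≋
              (t ⊗₁ id {A}) ∘ swap₂
            ≋⟨ ≋-sym (∘⟨⟩-assoc refl (sym assoc₀)) ⟩
              ((t ⊗₁ id {A}) ∘ (s ⊗₁ id {A})) ∘⟨ sym assoc₀ ⟩ (id {A} ⊗₁ s)
            ≋⟨ ∘⟨⟩-resp-≋ ≋-refl (≡⇒≋ (trans (sym ⊗-∘) (trans (cong₂ _⊗₁_ σ-involutive identityˡ) ⊗-id))) (sym assoc₀) (sym assoc₀) ⟩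
              id ∘⟨ sym assoc₀ ⟩ (id {A} ⊗₁ s)
            ≋⟨ ∘⟨⟩-identityˡ (sym assoc₀) ⟩
              id {A} ⊗₁ s
            ∎≋
      split-swap₂ : swap₂ ⊗₁ id {B} ≋ ((s ⊗₁ id {A}) ⊗₁ id {B}) ∘⟨ e₃ ⟩ ((id {A} ⊗₁ s) ⊗₁ id {B})
      split-swap₂ = begin≋
          swap₂ ⊗₁ id {B}
        ≋⟨ ⊗-resp-≋ ≋-refl (≋-sym (∘⟨⟩-identityˡ refl)) ⟩
          swap₂ ⊗₁ (id {B} ∘ id {B})
        ≋⟨ ≋-sym (⊗-∘⟨⟩ (sym assoc₀) refl e₃) ⟩
          ((s ⊗₁ id {A}) ⊗₁ id {B}) ∘⟨ e₃ ⟩ ((id {A} ⊗₁ s) ⊗₁ id {B})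
        ∎≋
      σ⊗σ-factor : (id {B} ⊗₁ (id {A} ⊗₁ s)) ∘⟨ e₂ ⟩ ((s ⊗₁ id {A}) ⊗₁ id {B}) ≋ s ⊗₁ s
      σ⊗σ-factor = begin≋
          (id {B} ⊗₁ (id {A} ⊗₁ s)) ∘⟨ e₂ ⟩ ((s ⊗₁ id {A}) ⊗₁ id {B})
        ≋⟨ ∘⟨⟩-resp-≋ (≋-trans ⊗-assoc-≋ (⊗-resp-≋ ≋-refl ⊗-id-≋)) (≋-trans (≋-sym ⊗-assoc-≋) (⊗-resp-≋ ⊗-id-≋ ≋-refl)) e₂ refl ⟩
          (id {B ⊗₀ A} ⊗₁ s) ∘ (s ⊗₁ id {A ⊗₀ B})
        ≋⟨ ≡⇒≋ (trans (sym ⊗-∘) (cong₂ _⊗₁_ identityˡ identityʳ)) ⟩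
          s ⊗₁ s
        ∎≋

  σ-deterministic : Deterministic (σ {A} {B})
  σ-deterministic {A} {B} = ≋⇒≡ (begin≋
      copy ∘ σ {A} {B}
    ≋⟨ ∘-resp-≋ ≋-refl (copy-⊗-≋ {B} {A}) ⟩
      ((id {B} ⊗₁ (σ {B} {A} ⊗₁ id {A})) ∘⟨ shuffle₀ {B} {A} ⟩ (copy ⊗₁ copy)) ∘ σ {A} {B}
    ≋⟨ ∘⟨⟩-assoc (shuffle₀ {B} {A}) refl ⟩
      (id {B} ⊗₁ (σ {B} {A} ⊗₁ id {A})) ∘⟨ shuffle₀ {B} {A} ⟩ ((copy ⊗₁ copy) ∘ σ {A} {B})
    ≋⟨ ∘⟨⟩-resp-≋ (≡⇒≋ (sym σ-natural)) ≋-refl (shuffle₀ {B} {A}) (shuffle₀ {B} {A}) ⟩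
      (id {B} ⊗₁ (σ {B} {A} ⊗₁ id {A})) ∘⟨ shuffle₀ {B} {A} ⟩ (σ ∘ (copy {A} ⊗₁ copy {B}))
    ≋⟨ ≋-sym (∘⟨⟩-assoc (shuffle₀ {B} {A}) refl) ⟩
      ((id {B} ⊗₁ (σ {B} {A} ⊗₁ id {A})) ∘⟨ shuffle₀ {B} {A} ⟩ σ) ∘ (copy {A} ⊗₁ copy {B})
    ≋⟨ ∘⟨⟩-resp-≋ ≋-refl interchange-σ refl (shuffle₀ {A} {B}) ⟩
      ((σ {A} {B} ⊗₁ σ {A} {B}) ∘⟨ unshuffle₀ ⟩ (id {A} ⊗₁ (σ {A} {B} ⊗₁ id {B}))) ∘⟨ shuffle₀ {A} {B} ⟩ (copy {A} ⊗₁ copy {B})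
    ≋⟨ ∘⟨⟩-assoc unshuffle₀ (shuffle₀ {A} {B}) ⟩
      (σ {A} {B} ⊗₁ σ {A} {B}) ∘⟨ unshuffle₀ ⟩ ((id {A} ⊗₁ (σ {A} {B} ⊗₁ id {B})) ∘⟨ shuffle₀ {A} {B} ⟩ (copy {A} ⊗₁ copy {B}))
    ≋⟨ ∘⟨⟩-resp-≋ (≋-sym copy-⊗-≋) ≋-refl unshuffle₀ refl ⟩
      (σ {A} {B} ⊗₁ σ {A} {B}) ∘ copy
    ∎≋)

  graph-⊗-del : (F : Hom A D) (G : Hom B I) →
                graph (F ⊗₁ G) ≋ (id {A} ⊗₁ σ {D} {B}) ∘⟨ assoc₀ ⟩ (graph F ⊗₁ id {B})
  graph-⊗-del {A} {D} {B} F G = begin≋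
      (id {A ⊗₀ B} ⊗₁ (F ⊗₁ G)) ∘ copy {A ⊗₀ B}
    ≋⟨ ∘-resp-≋ copy-⊗-≋ regroup-id ⟩
      (id {A} ⊗₁ ((id {B} ⊗₁ F) ⊗₁ G)) ∘ ((id {A} ⊗₁ (σ {A} {B} ⊗₁ id {B})) ∘⟨ shuffle₀ {A} {B} ⟩ (copy {A} ⊗₁ copy {B}))
    ≋⟨ ≋-sym (∘⟨⟩-assoc refl (shuffle₀ {A} {B})) ⟩
      ((id {A} ⊗₁ ((id {B} ⊗₁ F) ⊗₁ G)) ∘ (id {A} ⊗₁ (σ {A} {B} ⊗₁ id {B}))) ∘⟨ shuffle₀ {A} {B} ⟩ (copy {A} ⊗₁ copy {B})
    ≋⟨ ∘⟨⟩-resp-≋ ≋-refl (≡⇒≋ slide-σ) (shuffle₀ {A} {B}) (shuffle₀ {A} {B}) ⟩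
      ((id {A} ⊗₁ (σ {D} {B} ⊗₁ id {I})) ∘ (id {A} ⊗₁ ((F ⊗₁ id {B}) ⊗₁ G))) ∘⟨ shuffle₀ {A} {B} ⟩ (copy {A} ⊗₁ copy {B})
    ≋⟨ ∘⟨⟩-assoc refl (shuffle₀ {A} {B}) ⟩
      (id {A} ⊗₁ (σ {D} {B} ⊗₁ id {I})) ∘ ((id {A} ⊗₁ ((F ⊗₁ id {B}) ⊗₁ G)) ∘⟨ shuffle₀ {A} {B} ⟩ (copy {A} ⊗₁ copy {B}))
    ≋⟨ ∘⟨⟩-resp-≋ discard-copy (⊗-resp-≋ ≋-refl ⊗-unitʳ-≋) refl assoc₀ ⟩
      (id {A} ⊗₁ σ {D} {B}) ∘⟨ assoc₀ ⟩ (graph F ⊗₁ id {B})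
    ∎≋
    where
      regroup-id : id {A ⊗₀ B} ⊗₁ (F ⊗₁ G) ≋ id {A} ⊗₁ ((id {B} ⊗₁ F) ⊗₁ G)
      regroup-id = ≋-trans (⊗-resp-≋ (≋-sym ⊗-id-≋) ≋-refl) (≋-trans ⊗-assoc-≋ (⊗-resp-≋ ≋-refl (≋-sym ⊗-assoc-≋)))
      slide-σ : (id {A} ⊗₁ ((id {B} ⊗₁ F) ⊗₁ G)) ∘ (id {A} ⊗₁ (σ {A} {B} ⊗₁ id {B}))
              ≡ (id {A} ⊗₁ (σ {D} {B} ⊗₁ id {I})) ∘ (id {A} ⊗₁ ((F ⊗₁ id {B}) ⊗₁ G))
      slide-σ = trans (sym ⊗-∘) (trans (cong₂ _⊗₁_ (trans identityˡ (sym identityˡ))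
                (trans (sym ⊗-∘) (trans (cong₂ _⊗₁_ (sym σ-natural) (trans identityʳ (sym identityˡ))) ⊗-∘))) ⊗-∘)
      discard-copy : (id {A} ⊗₁ ((F ⊗₁ id {B}) ⊗₁ G)) ∘⟨ shuffle₀ {A} {B} ⟩ (copy {A} ⊗₁ copy {B})
          ≋ graph F ⊗₁ id {B}
      discard-copy = begin≋
          (id {A} ⊗₁ ((F ⊗₁ id {B}) ⊗₁ G)) ∘⟨ shuffle₀ {A} {B} ⟩ (copy {A} ⊗₁ copy {B})
        ≋⟨ ∘⟨⟩-resp-≋ ≋-refl (≋-trans (⊗-resp-≋ ≋-refl ⊗-assoc-≋) (≋-sym ⊗-assoc-≋)) (shuffle₀ {A} {B}) refl ⟩
          ((id {A} ⊗₁ F) ⊗₁ (id {B} ⊗₁ G)) ∘ (copy {A} ⊗₁ copy {B})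
        ≋⟨ ≡⇒≋ (sym ⊗-∘) ⟩
          graph F ⊗₁ graph G
        ≋⟨ ⊗-resp-≋ ≋-refl (≋-trans (≡⇒≋ (cong graph (del-unique G))) graph-del) ⟩
          graph F ⊗₁ id {B}
        ∎≋

module Rewirings {o ℓ} (V : VarStructure) (C : StrictMarkovCategory o ℓ)
                 (θ : VarStructure.Var V → StrictMarkovCategory.Obj C) where
  open StrictMarkovCategory C
  open HeterogeneousHom C
  open MarkovLaws C
  open CTheta V C θ

  ⊗Θ-≋ : ∀ {xs ys us vs} (f : HomΘ xs ys) (g : HomΘ us vs) → mor (f ⊗Θ g) ≋ mor f ⊗₁ mor g
  ⊗Θ-≋ {xs} {ys} {us} {vs} f g = subst₂-≋ (sym (split xs us)) (sym (split ys vs)) _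

  castΘ-≋ : ∀ {xs xs' ys ys'} (p : xs ≡ xs') (q : ys ≡ ys') (f : HomΘ xs ys) → mor (castΘ p q f) ≋ mor f
  castΘ-≋ refl refl f = ≋-refl

  copyΘ-≋ : ∀ xs → mor (copyΘ xs) ≋ copy {⟦ xs ⟧}
  copyΘ-≋ xs = subst-≋ _ _

  ⟪_⟫ : ∀ {xs ys} → Rewiring xs ys → Hom ⟦ xs ⟧ ⟦ ys ⟧
  ⟪ r ⟫ = mor ⟦ r ⟧ʳ

  r-inv : ∀ {xs ys} → Rewiring xs ys → Rewiring ys xs
  r-inv (r-id xs) = r-id xs
  r-inv (r-∘ r s) = r-∘ (r-inv s) (r-inv r)
  r-inv (r-⊗ r s) = r-⊗ (r-inv r) (r-inv s)
  r-inv (r-sym xs ys) = r-sym ys xs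

  r-cast : ∀ {xs ys} → xs ≡ ys → Rewiring xs ys
  r-cast {xs} p = subst (Rewiring xs) p (r-id xs)

  r-cast-≋ : ∀ {xs ys} (p : xs ≡ ys) → ⟪ r-cast p ⟫ ≋ id {⟦ xs ⟧}
  r-cast-≋ refl = ≋-refl

  private
    variable
      A A' B B' : Obj

    inverseˡ-resp-≋ : {f : Hom A B} {f₀ : Hom A' B'} {g : Hom B A} {g₀ : Hom B' A'} →
                      f ≋ f₀ → g ≋ g₀ → g₀ ∘ f₀ ≡ id → g ∘ f ≡ id
    inverseˡ-resp-≋ ≋-refl ≋-refl e = e

    deterministic-resp-≋ : {f : Hom A B} {f₀ : Hom A' B'} → f ≋ f₀ → Deterministic f₀ → Deterministic f
    deterministic-resp-≋ ≋-refl e = e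

  r-inv-inverseˡ : ∀ {xs ys} (r : Rewiring xs ys) → ⟪ r-inv r ⟫ ∘ ⟪ r ⟫ ≡ id
  r-inv-inverseˡ (r-id xs) = identityˡ
  r-inv-inverseˡ (r-∘ r s) = begin
      (⟪ r-inv s ⟫ ∘ ⟪ r-inv r ⟫) ∘ (⟪ r ⟫ ∘ ⟪ s ⟫)   ≡⟨ assoc ⟩
      ⟪ r-inv s ⟫ ∘ (⟪ r-inv r ⟫ ∘ (⟪ r ⟫ ∘ ⟪ s ⟫))   ≡⟨ cong (⟪ r-inv s ⟫ ∘_) (sym assoc) ⟩
      ⟪ r-inv s ⟫ ∘ ((⟪ r-inv r ⟫ ∘ ⟪ r ⟫) ∘ ⟪ s ⟫)   ≡⟨ cong (λ z → ⟪ r-inv s ⟫ ∘ (z ∘ ⟪ s ⟫)) (r-inv-inverseˡ r) ⟩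
      ⟪ r-inv s ⟫ ∘ (id ∘ ⟪ s ⟫)                     ≡⟨ cong (⟪ r-inv s ⟫ ∘_) identityˡ ⟩
      ⟪ r-inv s ⟫ ∘ ⟪ s ⟫                            ≡⟨ r-inv-inverseˡ s ⟩
      id                                             ∎
    where open ≡-Reasoning
  r-inv-inverseˡ (r-⊗ r s) = inverseˡ-resp-≋ (⊗Θ-≋ ⟦ r ⟧ʳ ⟦ s ⟧ʳ) (⊗Θ-≋ ⟦ r-inv r ⟧ʳ ⟦ r-inv s ⟧ʳ)
    (trans (sym ⊗-∘) (trans (cong₂ _⊗₁_ (r-inv-inverseˡ r) (r-inv-inverseˡ s)) ⊗-id))
  r-inv-inverseˡ (r-sym xs ys) = inverseˡ-resp-≋ (subst₂-≋ _ _ _) (subst₂-≋ _ _ _) σ-involutive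

  rewiring-deterministic : ∀ {xs ys} (r : Rewiring xs ys) → Deterministic ⟪ r ⟫
  rewiring-deterministic (r-id xs) = trans identityʳ (trans (sym identityˡ) (cong (_∘ copy) (sym ⊗-id)))
  rewiring-deterministic (r-∘ r s) = begin
      copy ∘ (⟪ r ⟫ ∘ ⟪ s ⟫)                           ≡⟨ sym assoc ⟩
      (copy ∘ ⟪ r ⟫) ∘ ⟪ s ⟫                           ≡⟨ cong (_∘ ⟪ s ⟫) (rewiring-deterministic r) ⟩
      ((⟪ r ⟫ ⊗₁ ⟪ r ⟫) ∘ copy) ∘ ⟪ s ⟫                ≡⟨ assoc ⟩
      (⟪ r ⟫ ⊗₁ ⟪ r ⟫) ∘ (copy ∘ ⟪ s ⟫)                ≡⟨ cong ((⟪ r ⟫ ⊗₁ ⟪ r ⟫) ∘_) (rewiring-deterministic s) ⟩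
      (⟪ r ⟫ ⊗₁ ⟪ r ⟫) ∘ ((⟪ s ⟫ ⊗₁ ⟪ s ⟫) ∘ copy)     ≡⟨ sym assoc ⟩
      ((⟪ r ⟫ ⊗₁ ⟪ r ⟫) ∘ (⟪ s ⟫ ⊗₁ ⟪ s ⟫)) ∘ copy     ≡⟨ cong (_∘ copy) (sym ⊗-∘) ⟩
      ((⟪ r ⟫ ∘ ⟪ s ⟫) ⊗₁ (⟪ r ⟫ ∘ ⟪ s ⟫)) ∘ copy     ∎
    where open ≡-Reasoning
  rewiring-deterministic (r-⊗ r s) = deterministic-resp-≋ (⊗Θ-≋ ⟦ r ⟧ʳ ⟦ s ⟧ʳ)
    (deterministic-⊗ (rewiring-deterministic r) (rewiring-deterministic s))
  rewiring-deterministic (r-sym xs ys) = deterministic-resp-≋ (subst₂-≋ _ _ _) σ-deterministic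

module Kernels {o ℓ} (V : VarStructure) (C : StrictMarkovCategory o ℓ)
               (θ : VarStructure.Var V → StrictMarkovCategory.Obj C) where
  open VarStructure V using (Var; isStrictTotalOrder)
  open IsStrictTotalOrder isStrictTotalOrder using (_≟_)
  open import Data.List.Membership.DecPropositional _≟_ using (_∈?_)
  open StrictMarkovCategory C
  open HeterogeneousHom C
  open MarkovLaws C
  open CTheta V C θ
  open Rewirings V C θ

  ∩ˡ-disjoint : ∀ xs ys → Disjoint ys xs → xs ∩ˡ ys ≡ []
  ∩ˡ-disjoint xs ys d = filter-none (_∈? ys) (tabulate λ x∈xs x∈ys → d (x∈ys , x∈xs))

  ∖ˡ-disjoint : ∀ xs ys → Disjoint ys xs → xs ∖ˡ ys ≡ xs
  ∖ˡ-disjoint xs ys d = filter-all (λ x → ¬? (x ∈? ys)) (tabulate λ x∈xs x∈ys → d (x∈ys , x∈xs))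

  ∖ˡ-self : ∀ xs → xs ∖ˡ xs ≡ []
  ∖ˡ-self xs = filter-none (λ x → ¬? (x ∈? xs)) (tabulate λ x∈xs x∉xs → x∉xs x∈xs)

  module KernelGraph {a y d : List Var} {f : HomΘ a y} {f' : HomΘ a d} {σ' : Rewiring (a ++ d) y}
           (f-kernel : f ≡ ⟦ σ' ⟧ʳ ∘Θ (idΘ a ⊗Θ f') ∘Θ copyΘ a) where

    r-inv-kernel : ∀ {c} (g : Hom c ⟦ a ⟧) →
                   ⟪ r-inv σ' ⟫ ∘ (mor f ∘ g) ≡ mor (idΘ a ⊗Θ f') ∘ (mor (copyΘ a) ∘ g)
    r-inv-kernel g = begin
        ⟪ r-inv σ' ⟫ ∘ (mor f ∘ g)               ≡⟨ cong (λ h → ⟪ r-inv σ' ⟫ ∘ (mor h ∘ g)) f-kernel ⟩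
        ⟪ r-inv σ' ⟫ ∘ ((⟪ σ' ⟫ ∘ (T ∘ cp)) ∘ g) ≡⟨ cong (⟪ r-inv σ' ⟫ ∘_) assoc ⟩
        ⟪ r-inv σ' ⟫ ∘ (⟪ σ' ⟫ ∘ ((T ∘ cp) ∘ g)) ≡⟨ sym assoc ⟩
        (⟪ r-inv σ' ⟫ ∘ ⟪ σ' ⟫) ∘ ((T ∘ cp) ∘ g) ≡⟨ cong (_∘ ((T ∘ cp) ∘ g)) (r-inv-inverseˡ σ') ⟩
        id ∘ ((T ∘ cp) ∘ g)                      ≡⟨ trans identityˡ assoc ⟩
        T ∘ (cp ∘ g)                             ∎
      where
        open ≡-Reasoning
        T = mor (idΘ a ⊗Θ f')
        cp = mor (copyΘ a)

    graph-rewired : ∀ {a'} (ρ : Rewiring a' a) →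
      ⟪ r-∘ (r-⊗ (r-inv ρ) (r-id d)) (r-inv σ') ⟫ ∘ (mor f ∘ ⟪ ρ ⟫) ≋ graph (mor f' ∘ ⟪ ρ ⟫)
    graph-rewired {a'} ρ = begin≋
        (⟪ r-⊗ (r-inv ρ) (r-id d) ⟫ ∘ ⟪ r-inv σ' ⟫) ∘ (mor f ∘ R)
      ≋⟨ ≡⇒≋ (trans assoc (cong (⟪ r-⊗ (r-inv ρ) (r-id d) ⟫ ∘_) (r-inv-kernel R))) ⟩
        ⟪ r-⊗ (r-inv ρ) (r-id d) ⟫ ∘ (mor (idΘ a ⊗Θ f') ∘ (mor (copyΘ a) ∘ R))
      ≋⟨ ∘-resp-≋ (∘-resp-≋ (∘-resp-≋ ≋-refl (copyΘ-≋ a)) (⊗Θ-≋ (idΘ a) f')) (⊗Θ-≋ ⟦ r-inv ρ ⟧ʳ (idΘ d)) ⟩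
        (R⁻¹ ⊗₁ id) ∘ ((id ⊗₁ mor f') ∘ (copy ∘ R))
      ≋⟨ ≡⇒≋ (cong (λ h → (R⁻¹ ⊗₁ id) ∘ ((id ⊗₁ mor f') ∘ h)) (rewiring-deterministic ρ)) ⟩
        (R⁻¹ ⊗₁ id) ∘ ((id ⊗₁ mor f') ∘ ((R ⊗₁ R) ∘ copy))
      ≋⟨ ≡⇒≋ (trans (cong ((R⁻¹ ⊗₁ id) ∘_) (sym assoc)) (sym assoc)) ⟩
        ((R⁻¹ ⊗₁ id) ∘ ((id ⊗₁ mor f') ∘ (R ⊗₁ R))) ∘ copy
      ≋⟨ ≡⇒≋ (cong (_∘ copy) (trans (cong ((R⁻¹ ⊗₁ id) ∘_) (sym ⊗-∘)) (sym ⊗-∘))) ⟩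
        ((R⁻¹ ∘ (id ∘ R)) ⊗₁ (id ∘ (mor f' ∘ R))) ∘ copy
      ≋⟨ ≡⇒≋ (cong (_∘ copy) (cong₂ _⊗₁_ (trans (cong (R⁻¹ ∘_) identityˡ) (r-inv-inverseˡ ρ)) identityˡ)) ⟩
        graph (mor f' ∘ R)
      ∎≋
      where
        R = ⟪ ρ ⟫
        R⁻¹ = ⟪ r-inv ρ ⟫

    unwire-⊗ : ∀ {a'} → Rewiring a' a → (b : List Var) → Rewiring (y ++ b) (a' ++ (b ++ d))
    unwire-⊗ {a'} ρ b =
      r-∘ (r-⊗ (r-id a') (r-sym d b))
          (r-∘ (r-cast (++-assoc a' d b)) (r-⊗ (r-∘ (r-⊗ (r-inv ρ) (r-id d)) (r-inv σ')) (r-id b)))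

    kernel-⊗-id-as-graph : ∀ {a'} (ρ : Rewiring a' a) (b : List Var) →
      ⟪ unwire-⊗ ρ b ⟫ ∘ (mor (f ⊗Θ idΘ b) ∘ ⟪ r-⊗ ρ (r-id b) ⟫)
        ≋ (id ⊗₁ σ {⟦ d ⟧} {⟦ b ⟧}) ∘⟨ assoc₀ ⟩ (graph (mor f' ∘ ⟪ ρ ⟫) ⊗₁ id)
    kernel-⊗-id-as-graph {a'} ρ b = begin≋
        (Swap ∘ (Assoc ∘ Unwire)) ∘ (mor (f ⊗Θ idΘ b) ∘ ⟪ r-⊗ ρ (r-id b) ⟫)
      ≋⟨ ≋-trans (∘⟨⟩-assoc refl refl) (∘-resp-≋ (∘⟨⟩-assoc refl refl) ≋-refl) ⟩
        Swap ∘ (Assoc ∘ (Unwire ∘ (mor (f ⊗Θ idΘ b) ∘ ⟪ r-⊗ ρ (r-id b) ⟫)))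
      ≋⟨ ∘⟨⟩-resp-≋ (∘⟨⟩-elimˡ (r-cast-≋ (++-assoc a' d b)) refl _) ≋-refl refl (cong ⟦_⟧ (++-assoc a' d b)) ⟩
        Swap ∘⟨ cong ⟦_⟧ (++-assoc a' d b) ⟩ (Unwire ∘ (mor (f ⊗Θ idΘ b) ∘ ⟪ r-⊗ ρ (r-id b) ⟫))
      ≋⟨ ∘⟨⟩-resp-≋ unwire-graph swap-≋ _ assoc₀ ⟩
        (id ⊗₁ σ) ∘⟨ assoc₀ ⟩ (graph (mor f' ∘ ⟪ ρ ⟫) ⊗₁ id)
      ∎≋
      where
        Swap = ⟪ r-⊗ (r-id a') (r-sym d b) ⟫
        Assoc = ⟪ r-cast (++-assoc a' d b) ⟫
        swap-≋ : Swap ≋ id ⊗₁ σ {⟦ d ⟧} {⟦ b ⟧}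
        swap-≋ = ≋-trans (⊗Θ-≋ (idΘ a') ⟦ r-sym d b ⟧ʳ) (⊗-resp-≋ ≋-refl (subst₂-≋ _ _ _))
        U = ⟪ r-∘ (r-⊗ (r-inv ρ) (r-id d)) (r-inv σ') ⟫
        Unwire = ⟪ r-⊗ (r-∘ (r-⊗ (r-inv ρ) (r-id d)) (r-inv σ')) (r-id b) ⟫
        unwire-graph : Unwire ∘ (mor (f ⊗Θ idΘ b) ∘ ⟪ r-⊗ ρ (r-id b) ⟫) ≋ graph (mor f' ∘ ⟪ ρ ⟫) ⊗₁ id {⟦ b ⟧}
        unwire-graph = begin≋
            Unwire ∘ (mor (f ⊗Θ idΘ b) ∘ ⟪ r-⊗ ρ (r-id b) ⟫)
          ≋⟨ ∘-resp-≋ (∘-resp-≋ (⊗Θ-≋ ⟦ ρ ⟧ʳ (idΘ b)) (⊗Θ-≋ f (idΘ b)))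
                      (⊗Θ-≋ ⟦ r-∘ (r-⊗ (r-inv ρ) (r-id d)) (r-inv σ') ⟧ʳ (idΘ b)) ⟩
            (U ⊗₁ id) ∘ ((mor f ⊗₁ id) ∘ (⟪ ρ ⟫ ⊗₁ id))
          ≋⟨ ≡⇒≋ (trans (cong ((U ⊗₁ id) ∘_) (sym ⊗-∘)) (trans (sym ⊗-∘) (cong ((U ∘ (mor f ∘ ⟪ ρ ⟫)) ⊗₁_) (trans identityˡ identityˡ)))) ⟩
            (U ∘ (mor f ∘ ⟪ ρ ⟫)) ⊗₁ id
          ≋⟨ ⊗-resp-≋ (graph-rewired ρ) ≋-refl ⟩
            graph (mor f' ∘ ⟪ ρ ⟫) ⊗₁ id
          ∎≋

  split₃ : ∀ a b d → ⟦ a ⟧ ⊗₀ (⟦ b ⟧ ⊗₀ ⟦ d ⟧) ≡ ⟦ (a ++ b) ++ (d ++ []) ⟧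
  split₃ a b d = sym (trans (split (a ++ b) (d ++ []))
                   (trans (cong₂ _⊗₀_ (split a b) (trans (split d []) unitʳ₀)) assoc₀))

  oplus-del-as-graph : ∀ {a b d P Q} (f' : HomΘ a d) (g' : HomΘ b [])
    (ρ₁ : Rewiring (a ++ []) a) (ρ₂ : Rewiring b b) (σ₁ : Rewiring P (a ++ b))
    (σ₂ : Rewiring ((a ++ b) ++ (d ++ [])) Q) (re : (a ++ []) ++ b ≡ a ++ b) →
    mor (⟦ σ₂ ⟧ʳ
         ∘Θ (idΘ (a ++ b) ⊗Θ castΘ re refl ((f' ∘Θ ⟦ ρ₁ ⟧ʳ) ⊗Θ (g' ∘Θ ⟦ ρ₂ ⟧ʳ)))
         ∘Θ (idΘ (a ++ b) ⊗Θ (idΘ a ⊗Θ (copyΘ [] ⊗Θ idΘ b)))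
         ∘Θ copyΘ (a ++ b)
         ∘Θ ⟦ σ₁ ⟧ʳ)
      ≋ ⟪ σ₂ ⟫ ∘⟨ split₃ a b d ⟩
          (((id ⊗₁ σ) ∘⟨ assoc₀ ⟩ (graph (mor f' ∘ ⟪ r-∘ ρ₁ (r-cast (sym (++-identityʳ a))) ⟫) ⊗₁ id))
           ∘⟨ split a b ⟩ ⟪ σ₁ ⟫)
  oplus-del-as-graph {a} {b} {d} f' g' ρ₁ ρ₂ σ₁ σ₂ re =
    ∘⟨⟩-resp-≋ composite ≋-refl refl (split₃ a b d)
    where
      F = mor f' ∘ ⟪ r-∘ ρ₁ (r-cast (sym (++-identityʳ a))) ⟫
      X = (f' ∘Θ ⟦ ρ₁ ⟧ʳ) ⊗Θ (g' ∘Θ ⟦ ρ₂ ⟧ʳ)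
      Apply = mor (idΘ (a ++ b) ⊗Θ castΘ re refl X)
      Copy₀ = mor (idΘ (a ++ b) ⊗Θ (idΘ a ⊗Θ (copyΘ [] ⊗Θ idΘ b)))
      Copy = mor (copyΘ (a ++ b))

      f'ρ₁-≋ : mor f' ∘ ⟪ ρ₁ ⟫ ≋ F
      f'ρ₁-≋ = ∘-resp-≋ (≋-sym (≋-trans (∘⟨⟩-resp-≋ (r-cast-≋ p) ≋-refl refl (cong ⟦_⟧ p))
                                           (∘⟨⟩-identityʳ (cong ⟦_⟧ p)))) ≋-refl
        where p = sym (++-identityʳ a)

      Apply-≋ : Apply ≋ id {⟦ a ⟧ ⊗₀ ⟦ b ⟧} ⊗₁ (F ⊗₁ mor (g' ∘Θ ⟦ ρ₂ ⟧ʳ))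
      Apply-≋ = ≋-trans (⊗Θ-≋ (idΘ (a ++ b)) (castΘ re refl X))
                  (⊗-resp-≋ (id-≋ (split a b))
                    (≋-trans (castΘ-≋ re refl X)
                      (≋-trans (⊗Θ-≋ (f' ∘Θ ⟦ ρ₁ ⟧ʳ) (g' ∘Θ ⟦ ρ₂ ⟧ʳ)) (⊗-resp-≋ f'ρ₁-≋ ≋-refl))))

      Copy₀-≋ : Copy₀ ≋ id {⟦ a ++ b ⟧ ⊗₀ (⟦ a ⟧ ⊗₀ (I ⊗₀ ⟦ b ⟧))}
      Copy₀-≋ =
        ≋-trans (⊗Θ-≋ (idΘ (a ++ b)) (idΘ a ⊗Θ (copyΘ [] ⊗Θ idΘ b)))
          (≋-trans (⊗-resp-≋ ≋-refl
                     (≋-trans (⊗Θ-≋ (idΘ a) (copyΘ [] ⊗Θ idΘ b))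
                       (⊗-resp-≋ ≋-refl
                         (≋-trans (⊗Θ-≋ (copyΘ []) (idΘ b))
                           (≋-trans (⊗-resp-≋ (≋-trans (copyΘ-≋ []) copy-I-≋) ≋-refl) ⊗-id-≋)))))
            (≋-trans (⊗-resp-≋ ≋-refl ⊗-id-≋) ⊗-id-≋))

      composite : Apply ∘ (Copy₀ ∘ (Copy ∘ ⟪ σ₁ ⟫))
                  ≋ ((id ⊗₁ σ) ∘⟨ assoc₀ ⟩ (graph F ⊗₁ id)) ∘⟨ split a b ⟩ ⟪ σ₁ ⟫
      composite = begin≋
          Apply ∘ (Copy₀ ∘ (Copy ∘ ⟪ σ₁ ⟫))
        ≋⟨ ∘-resp-≋ (∘⟨⟩-elimˡ Copy₀-≋ refl (Copy ∘ ⟪ σ₁ ⟫)) ≋-refl ⟩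
          Apply ∘ (Copy ∘ ⟪ σ₁ ⟫)
        ≋⟨ ≋-sym (∘⟨⟩-assoc refl refl) ⟩
          (Apply ∘ Copy) ∘ ⟪ σ₁ ⟫
        ≋⟨ ∘⟨⟩-resp-≋ ≋-refl (∘-resp-≋ (≋-trans (copyΘ-≋ (a ++ b)) (copy-≋ (split a b))) Apply-≋) refl (split a b) ⟩
          graph (F ⊗₁ mor (g' ∘Θ ⟦ ρ₂ ⟧ʳ)) ∘⟨ split a b ⟩ ⟪ σ₁ ⟫
        ≋⟨ ∘⟨⟩-resp-≋ ≋-refl (graph-⊗-del F _) (split a b) (split a b) ⟩
          ((id ⊗₁ σ) ∘⟨ assoc₀ ⟩ (graph F ⊗₁ id)) ∘⟨ split a b ⟩ ⟪ σ₁ ⟫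
        ∎≋

  -- L, L₁, L₂, K are generalised so that the hypotheses about them can be
  -- matched against refl; X ∩ U, X ∖ U, … in the theorem are not variables.
  oplus-id-factors : ∀ {a b y d P Q L L₁ L₂ K : List Var} →
    L ≡ [] → L₁ ≡ a → L₂ ≡ b → K ≡ [] →
    {f : HomΘ a y} {f' : HomΘ a d} {σ' : Rewiring (a ++ d) y} →
    f ≡ ⟦ σ' ⟧ʳ ∘Θ (idΘ a ⊗Θ f') ∘Θ copyΘ a →
    (g' : HomΘ b K) (σ₁ : Rewiring P (L₁ ++ L ++ L₂)) (ρ₁ : Rewiring (L₁ ++ L) a)
    (ρ₂ : Rewiring (L ++ L₂) b) (σ₂ : Rewiring ((L₁ ++ L ++ L₂) ++ (d ++ K)) Q)
    (re : (L₁ ++ L) ++ (L ++ L₂) ≡ L₁ ++ ((L ++ L) ++ L₂)) (h : HomΘ P Q) →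
    h ≡ ⟦ σ₂ ⟧ʳ
        ∘Θ (idΘ (L₁ ++ L ++ L₂) ⊗Θ castΘ re refl ((f' ∘Θ ⟦ ρ₁ ⟧ʳ) ⊗Θ (g' ∘Θ ⟦ ρ₂ ⟧ʳ)))
        ∘Θ (idΘ (L₁ ++ L ++ L₂) ⊗Θ (idΘ L₁ ⊗Θ (copyΘ L ⊗Θ idΘ L₂)))
        ∘Θ copyΘ (L₁ ++ L ++ L₂)
        ∘Θ ⟦ σ₁ ⟧ʳ →
    Σ (Rewiring P (a ++ b)) λ τ₁ →
    Σ (Rewiring (y ++ b) Q) λ τ₂ →
      h ≡ ⟦ τ₂ ⟧ʳ ∘Θ (f ⊗Θ idΘ b) ∘Θ ⟦ τ₁ ⟧ʳ
  oplus-id-factors {a} {b} {y} {d} {P} {Q} refl refl refl refl {f} {f'} {σ'} f-kernel g' σ₁ ρ₁ ρ₂ σ₂ re h h-oplus =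
    τ₁ , τ₂ , trans h-oplus (cong homΘ (≋⇒≡ (≋-trans (oplus-del-as-graph f' g' ρ₁ ρ₂ σ₁ σ₂ re) (≋-sym factors))))
    where
      open KernelGraph {f' = f'} {σ' = σ'} f-kernel
      ρ : Rewiring a a
      ρ = r-∘ ρ₁ (r-cast (sym (++-identityʳ a)))
      regroup : a ++ (b ++ d) ≡ (a ++ b) ++ (d ++ [])
      regroup = trans (sym (++-assoc a b d)) (cong ((a ++ b) ++_) (sym (++-identityʳ d)))
      τ₁ : Rewiring P (a ++ b)
      τ₁ = r-∘ (r-⊗ ρ (r-id b)) σ₁
      τ₂ : Rewiring (y ++ b) Q
      τ₂ = r-∘ σ₂ (r-∘ (r-cast regroup) (unwire-⊗ ρ b))

      kernel-part : (⟪ r-cast regroup ⟫ ∘ ⟪ unwire-⊗ ρ b ⟫) ∘ (mor (f ⊗Θ idΘ b) ∘ (⟪ r-⊗ ρ (r-id b) ⟫ ∘ ⟪ σ₁ ⟫))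
                    ≋ ((id ⊗₁ σ) ∘⟨ assoc₀ ⟩ (graph (mor f' ∘ ⟪ ρ ⟫) ⊗₁ id)) ∘⟨ split a b ⟩ ⟪ σ₁ ⟫
      kernel-part = begin≋
          (⟪ r-cast regroup ⟫ ∘ Unwire) ∘ (Fb ∘ (Rb ∘ ⟪ σ₁ ⟫))
        ≋⟨ ∘⟨⟩-assoc refl refl ⟩
          ⟪ r-cast regroup ⟫ ∘ (Unwire ∘ (Fb ∘ (Rb ∘ ⟪ σ₁ ⟫)))
        ≋⟨ ∘⟨⟩-elimˡ (r-cast-≋ regroup) refl _ ⟩
          Unwire ∘ (Fb ∘ (Rb ∘ ⟪ σ₁ ⟫))
        ≋⟨ ≡⇒≋ (trans (cong (Unwire ∘_) (sym assoc)) (sym assoc)) ⟩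
          (Unwire ∘ (Fb ∘ Rb)) ∘ ⟪ σ₁ ⟫
        ≋⟨ ∘⟨⟩-resp-≋ ≋-refl (kernel-⊗-id-as-graph ρ b) refl (split a b) ⟩
          ((id ⊗₁ σ) ∘⟨ assoc₀ ⟩ (graph (mor f' ∘ ⟪ ρ ⟫) ⊗₁ id)) ∘⟨ split a b ⟩ ⟪ σ₁ ⟫
        ∎≋
        where
          Unwire = ⟪ unwire-⊗ ρ b ⟫
          Fb = mor (f ⊗Θ idΘ b)
          Rb = ⟪ r-⊗ ρ (r-id b) ⟫

      factors : mor (⟦ τ₂ ⟧ʳ ∘Θ (f ⊗Θ idΘ b) ∘Θ ⟦ τ₁ ⟧ʳ)
                ≋ ⟪ σ₂ ⟫ ∘⟨ split₃ a b d ⟩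
                    (((id ⊗₁ σ) ∘⟨ assoc₀ ⟩ (graph (mor f' ∘ ⟪ ρ ⟫) ⊗₁ id)) ∘⟨ split a b ⟩ ⟪ σ₁ ⟫)
      factors = ≋-trans (∘⟨⟩-assoc refl refl) (∘⟨⟩-resp-≋ kernel-part ≋-refl refl (split₃ a b d))

lemma1 : ∀ {o ℓ : Level} (V : VarStructure) (C : StrictMarkovCategory o ℓ)
           (θ : VarStructure.Var V → StrictMarkovCategory.Obj C) →
         let open CTheta V C θ
         in (X Y : FinSet) (f : HomΘ ⌈ X ⌉ ⌈ Y ⌉) → IsKernel X Y f →
            (U : FinSet) → Disjoint ⌈ U ⌉ ⌈ X ⌉ → Disjoint ⌈ U ⌉ ⌈ Y ⌉ →
            (X ∩ U ≡ Y ∩ U)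
            × (∀ (h : HomΘ (X ∪ U) (Y ∪ U)) → IsOplus X Y U U f (idΘ ⌈ U ⌉) h →
               Σ (Rewiring (X ∪ U) (⌈ X ⌉ ++ ⌈ U ⌉)) λ σ₁ →
               Σ (Rewiring (⌈ Y ⌉ ++ ⌈ U ⌉) (Y ∪ U)) λ σ₂ →
                 h ≡ ⟦ σ₂ ⟧ʳ ∘Θ (f ⊗Θ idΘ ⌈ U ⌉) ∘Θ ⟦ σ₁ ⟧ʳ)
lemma1 V C θ X Y f _ U U#X U#Y =
    trans (∩ˡ-disjoint ⌈ X ⌉ ⌈ U ⌉ U#X) (sym (∩ˡ-disjoint ⌈ Y ⌉ ⌈ U ⌉ U#Y))
  , λ { h (_ , f' , (σ' , f-kernel) , g' , _ , σ₁ , ρ₁ , ρ₂ , σ₂ , h-oplus) →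
        oplus-id-factors (∩ˡ-disjoint ⌈ X ⌉ ⌈ U ⌉ U#X) (∖ˡ-disjoint ⌈ X ⌉ ⌈ U ⌉ U#X)
          (∖ˡ-disjoint ⌈ U ⌉ ⌈ X ⌉ (λ (u∈X , u∈U) → U#X (u∈U , u∈X))) (∖ˡ-self ⌈ U ⌉)
          {σ' = σ'} f-kernel g' σ₁ ρ₁ ρ₂ σ₂
          (trans (++-assoc (X ∖ U) (X ∩ U) ((X ∩ U) ++ (U ∖ X)))
                 (cong ((X ∖ U) ++_) (sym (++-assoc (X ∩ U) (X ∩ U) (U ∖ X)))))
          h h-oplus }
  where
    open CTheta V C θ
    open Kernels V C θ
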